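{- Let $(G_1,a_1,a_1',b_1,b_1')$ and $(G_2,a_2,a_2',b_2,b_2')$ be two tuples satisfying the gluing property such that, for $i=1,2$: $G_i$ is $K_2$-hamiltonian; $G_i-a_i'$ has a hamiltonian cycle containing the edge $b_ib_i'$ and a hamiltonian cycle not containing $b_ib_i'$; and $G_i-v$ is hamiltonian for every $v\in N_{G_i}[b_i]$. Then the amalgam of $G_1$ and $G_2$ is $K_2$-hamiltonian.
   Context: All graphs are finite and simple. A graph is hamiltonian if it has a cycle through all its vertices; a graph $H$ is $K_2$-hamiltonian if $H-u-v$ is hamiltonian for every pair of adjacent vertices $u,v$. $N_{G}[v]$ is the set consisting of $v$ and its neighbours in $G$. A tuple $(G,a,a',b,b')$, where $G$ is a graph and $a,a',b,b'$ are pairwise distinct vertices of $G$, satisfies the gluing property if $a$ and $b$ have degree $3$, $a'$ and $b'$ have degree at least $3$, $aa',bb',ab\in E(G)$ and $ab',a'b,a'b'\notin E(G)$. Given two such tuples $(G_i,a_i,a_i',b_i,b_i')$, $i=1,2$, with $V(G_1)\cap V(G_2)=\emptyset$, let $E_i=E(G_i)\setminus\{a_ib_i,b_ib_i'\}$; the amalgam of $G_1$ and $G_2$ is obtained from the graph with vertex set $V(G_1)\cup V(G_2)$ and edge set $E_1\cup E_2\cup\{b_1b_2,b_1b_2',b_1'b_2\}$ by identifying $a_1$ with $a_2$ (into a vertex $a$) and $a_1'$ with $a_2'$ (into a vertex $a'$), the two copies of the edge $aa'$ being merged into one. -}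

module Defs where

open import Level using (0ℓ)
open import Data.Nat using (ℕ; _≥_)
open import Data.Bool using (Bool; true; false; not; _∨_; T)
open import Data.Bool.Properties using (T-irrelevant)
open import Data.Unit using (⊤; tt)
open import Data.Empty using (⊥; ⊥-elim)
open import Data.Sum using (_⊎_; inj₁; inj₂)
open import Data.Product using (Σ; Σ-syntax; _×_; _,_; proj₁; proj₂)
open import Data.List using (List; []; _∷_; _++_; [_]; zip; length)
open import Data.List.Membership.Propositional using (_∈_)
open import Data.List.Relation.Unary.All using (All)
open import Data.List.Relation.Unary.Any using (Any)
open import Data.List.Relation.Unary.Unique.Propositional using (Unique)
open import Relation.Nullary using (¬_; Dec; yes; no; does)
open import Relation.Binary.Definitions using (DecidableEquality)
open import Relation.Binary.PropositionalEquality using (_≡_; _≢_; refl; sym; cong)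
open import Function.Bundles using (_⇔_)

record Graph : Set₁ where
  field
    V      : Set
    _≟_    : DecidableEquality V
    E      : V → V → Set
    E-sym  : ∀ {u v} → E u v → E v u
    E-irr  : ∀ {v} → ¬ E v v

open Graph public

Finite : Graph → Set
Finite G = Σ[ vs ∈ List (V G) ] (∀ v → v ∈ vs)

-- Cycles, given as lists of distinct vertices x₀ … x_{k-1} (k ≥ 3) with
-- x_i x_{i+1} and x_{k-1} x₀ edges.

cyclePairs : {A : Set} → List A → List (A × A)
cyclePairs []       = []
cyclePairs (x ∷ xs) = zip (x ∷ xs) (xs ++ [ x ])

SamePair : {A : Set} → A → A → A → A → Set
SamePair x y p q = (x ≡ p × y ≡ q) ⊎ (x ≡ q × y ≡ p)

CycleHasEdge : {A : Set} → List A → A → A → Set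
CycleHasEdge c p q = Any (λ e → SamePair (proj₁ e) (proj₂ e) p q) (cyclePairs c)

-- c is a hamiltonian cycle of G - X, where X is the set of deleted
-- vertices (given as a predicate): a cycle of G whose vertex set is
-- exactly V(G) \ X.  (Cycles of the induced subgraph G - X are exactly
-- the cycles of G avoiding X.)
record HamCycleDel (G : Graph) (X : V G → Set) (c : List (V G)) : Set where
  field
    long     : length c ≥ 3
    distinct : Unique c
    avoids   : All (λ v → ¬ X v) c
    covers   : ∀ v → ¬ X v → v ∈ c
    edges    : All (λ e → E G (proj₁ e) (proj₂ e)) (cyclePairs c)

HamiltonianDel : (G : Graph) → (V G → Set) → Set
HamiltonianDel G X = Σ[ c ∈ List (V G) ] HamCycleDel G X c

Del₁ : (G : Graph) → V G → (V G → Set)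
Del₁ G u w = w ≡ u

Del₂ : (G : Graph) → V G → V G → (V G → Set)
Del₂ G u v w = (w ≡ u) ⊎ (w ≡ v)

K2Hamiltonian : Graph → Set
K2Hamiltonian G = ∀ u v → E G u v → HamiltonianDel G (Del₂ G u v)

HasDegree : (G : Graph) → V G → ℕ → Set
HasDegree G v k =
  Σ[ ns ∈ List (V G) ] (length ns ≡ k × Unique ns × (∀ w → E G v w ⇔ w ∈ ns))

DegreeAtLeast : (G : Graph) → V G → ℕ → Set
DegreeAtLeast G v k =
  Σ[ ns ∈ List (V G) ] (length ns ≥ k × Unique ns × All (E G v) ns)

record Gluing (G : Graph) (a a' b b' : V G) : Set where
  field
    a≢a'  : a ≢ a'
    a≢b   : a ≢ b
    a≢b'  : a ≢ b'
    a'≢b  : a' ≢ b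
    a'≢b' : a' ≢ b'
    b≢b'  : b ≢ b'
    deg-a  : HasDegree G a 3
    deg-b  : HasDegree G b 3
    deg-a' : DegreeAtLeast G a' 3
    deg-b' : DegreeAtLeast G b' 3
    aa'   : E G a a'
    bb'   : E G b b'
    ab    : E G a b
    ¬ab'  : ¬ E G a b'
    ¬a'b  : ¬ E G a' b
    ¬a'b' : ¬ E G a' b'

record Tuple : Set₁ where
  field
    G  : Graph
    a  : V G
    a' : V G
    b  : V G
    b' : V G
    glue : Gluing G a a' b b'

-- The amalgam.
-- Vertex set: V(G₁) ⊎ (V(G₂) \ {a₂, a₂'}); the vertex a₂ (resp. a₂') of
-- G₂ is identified with a₁ (resp. a₁') via the map ι₂ below.

module Amalgam (T₁ T₂ : Tuple) where
  open Tuple T₁ renaming (G to G₁; a to a₁; a' to a₁'; b to b₁; b' to b₁'; glue to gl₁)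
  open Tuple T₂ renaming (G to G₂; a to a₂; a' to a₂'; b to b₂; b' to b₂'; glue to gl₂)

  keep₂ : V G₂ → Bool
  keep₂ v = not (does (_≟_ G₂ v a₂) ∨ does (_≟_ G₂ v a₂'))

  V₂' : Set
  V₂' = Σ[ v ∈ V G₂ ] T (keep₂ v)

  AV : Set
  AV = V G₁ ⊎ V₂'

  keep-lemma : ∀ v → v ≢ a₂ → v ≢ a₂' → T (keep₂ v)
  keep-lemma v p q with _≟_ G₂ v a₂ | _≟_ G₂ v a₂'
  ... | yes e | _     = p e
  ... | no _  | yes e = q e
  ... | no _  | no _  = tt

  ι₂ : V G₂ → AV
  ι₂ v with _≟_ G₂ v a₂
  ... | yes _ = inj₁ a₁
  ... | no p with _≟_ G₂ v a₂'
  ...   | yes _ = inj₁ a₁'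
  ...   | no q  = inj₂ (v , keep-lemma v p q)

  E₁' : V G₁ → V G₁ → Set
  E₁' x y = E G₁ x y × ¬ SamePair x y a₁ b₁ × ¬ SamePair x y b₁ b₁'

  E₂' : V G₂ → V G₂ → Set
  E₂' x y = E G₂ x y × ¬ SamePair x y a₂ b₂ × ¬ SamePair x y b₂ b₂'

  NewEdge : AV → AV → Set
  NewEdge u w = SamePair u w (inj₁ b₁) (ι₂ b₂)
              ⊎ SamePair u w (inj₁ b₁) (ι₂ b₂')
              ⊎ SamePair u w (inj₁ b₁') (ι₂ b₂)

  AE : AV → AV → Set
  AE u w = (Σ[ x ∈ V G₁ ] Σ[ y ∈ V G₁ ] (u ≡ inj₁ x × w ≡ inj₁ y × E₁' x y))
         ⊎ (Σ[ x ∈ V G₂ ] Σ[ y ∈ V G₂ ] (u ≡ ι₂ x × w ≡ ι₂ y × E₂' x y))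
         ⊎ NewEdge u w

  private
    module GL₁ = Gluing gl₁
    module GL₂ = Gluing gl₂

  ι₂-inj₁ : ∀ v z → ι₂ v ≡ inj₁ z → (v ≡ a₂) ⊎ (v ≡ a₂')
  ι₂-inj₁ v z e with _≟_ G₂ v a₂
  ... | yes p = inj₁ p
  ... | no p with _≟_ G₂ v a₂'
  ...   | yes q = inj₂ q
  ι₂-inj₁ v z () | no p | no q

  ι₂-inj : ∀ x y → ι₂ x ≡ ι₂ y → x ≡ y
  ι₂-inj x y e with _≟_ G₂ x a₂ | _≟_ G₂ y a₂
  ... | yes p | yes q = Relation.Binary.PropositionalEquality.trans p (sym q)
  ... | yes p | no q with _≟_ G₂ y a₂'
  ...   | yes r = ⊥-elim (GL₁.a≢a' (inj₁-injective e))
    where open import Data.Sum.Properties using (inj₁-injective)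
  ι₂-inj x y () | yes p | no q | no r
  ι₂-inj x y e | no p | yes q with _≟_ G₂ x a₂'
  ... | yes r = ⊥-elim (GL₁.a≢a' (sym (inj₁-injective e)))
    where open import Data.Sum.Properties using (inj₁-injective)
  ι₂-inj x y () | no p | yes q | no r
  ι₂-inj x y e | no p | no q with _≟_ G₂ x a₂' | _≟_ G₂ y a₂'
  ... | yes r | yes s = Relation.Binary.PropositionalEquality.trans r (sym s)
  ι₂-inj x y () | no p | no q | yes r | no s
  ι₂-inj x y () | no p | no q | no r | yes s
  ι₂-inj x y e | no p | no q | no r | no s = cong proj₁ (inj₂-injective e)
    where open import Data.Sum.Properties using (inj₂-injective)

  private
    b₂-new : ∀ z → ι₂ b₂ ≢ inj₁ z
    b₂-new z e with ι₂-inj₁ b₂ z e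
    ... | inj₁ p = GL₂.a≢b (sym p)
    ... | inj₂ p = GL₂.a'≢b (sym p)

    b₂'-new : ∀ z → ι₂ b₂' ≢ inj₁ z
    b₂'-new z e with ι₂-inj₁ b₂' z e
    ... | inj₁ p = GL₂.a≢b' (sym p)
    ... | inj₂ p = GL₂.a'≢b' (sym p)

    open Relation.Binary.PropositionalEquality using (trans)

    same-irr : ∀ {u} z w → ι₂ w ≢ inj₁ z → ¬ SamePair u u (inj₁ z) (ι₂ w)
    same-irr z w n (inj₁ (p , q)) = n (trans (sym q) p)
    same-irr z w n (inj₂ (p , q)) = n (trans (sym p) q)

    same-sym : {A : Set} {x y p q : A} → SamePair x y p q → SamePair y x p q
    same-sym (inj₁ (p , q)) = inj₂ (q , p)
    same-sym (inj₂ (p , q)) = inj₁ (q , p)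

    E₁'-sym : ∀ {x y} → E₁' x y → E₁' y x
    E₁'-sym (e , n , m) = E-sym G₁ e , (λ s → n (same-sym s)) , (λ s → m (same-sym s))

    E₂'-sym : ∀ {x y} → E₂' x y → E₂' y x
    E₂'-sym (e , n , m) = E-sym G₂ e , (λ s → n (same-sym s)) , (λ s → m (same-sym s))

  AE-sym : ∀ {u w} → AE u w → AE w u
  AE-sym (inj₁ (x , y , p , q , e)) = inj₁ (y , x , q , p , E₁'-sym e)
  AE-sym (inj₂ (inj₁ (x , y , p , q , e))) = inj₂ (inj₁ (y , x , q , p , E₂'-sym e))
  AE-sym (inj₂ (inj₂ (inj₁ s))) = inj₂ (inj₂ (inj₁ (same-sym s)))
  AE-sym (inj₂ (inj₂ (inj₂ (inj₁ s)))) = inj₂ (inj₂ (inj₂ (inj₁ (same-sym s))))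
  AE-sym (inj₂ (inj₂ (inj₂ (inj₂ s)))) = inj₂ (inj₂ (inj₂ (inj₂ (same-sym s))))

  AE-irr : ∀ {u} → ¬ AE u u
  AE-irr (inj₁ (x , y , p , q , e , _)) =
    E-irr G₁ (Relation.Binary.PropositionalEquality.subst (E G₁ x) (sym (inj₁-injective (trans (sym p) q))) e)
    where open import Data.Sum.Properties using (inj₁-injective)
  AE-irr (inj₂ (inj₁ (x , y , p , q , e , _))) =
    E-irr G₂ (Relation.Binary.PropositionalEquality.subst (E G₂ x) (sym (ι₂-inj x y (trans (sym p) q))) e)
  AE-irr (inj₂ (inj₂ (inj₁ s))) = same-irr b₁ b₂ (b₂-new b₁) s
  AE-irr (inj₂ (inj₂ (inj₂ (inj₁ s)))) = same-irr b₁ b₂' (b₂'-new b₁) s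
  AE-irr (inj₂ (inj₂ (inj₂ (inj₂ s)))) = same-irr b₁' b₂ (b₂-new b₁') s

  AV-≟ : DecidableEquality AV
  AV-≟ (inj₁ x) (inj₁ y) with _≟_ G₁ x y
  ... | yes refl = yes refl
  ... | no n = no (λ { refl → n refl })
  AV-≟ (inj₁ x) (inj₂ y) = no (λ ())
  AV-≟ (inj₂ x) (inj₁ y) = no (λ ())
  AV-≟ (inj₂ (x , p)) (inj₂ (y , q)) with _≟_ G₂ x y
  ... | yes refl with T-irrelevant p q
  ...   | refl = yes refl
  AV-≟ (inj₂ (x , p)) (inj₂ (y , q)) | no n = no (λ { refl → n refl })

  amalgam : Graph
  amalgam = record
    { V = AV ; _≟_ = AV-≟ ; E = AE ; E-sym = AE-sym ; E-irr = AE-irr }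

open Amalgam public using (amalgam)

record Conditions (T' : Tuple) : Set where
  open Tuple T'
  field
    k2ham     : K2Hamiltonian G
    with-bb'  : Σ[ c ∈ List (V G) ] (HamCycleDel G (Del₁ G a') c × CycleHasEdge c b b')
    without-bb' : Σ[ c ∈ List (V G) ] (HamCycleDel G (Del₁ G a') c × ¬ CycleHasEdge c b b')
    closedNbhd : ∀ v → (v ≡ b) ⊎ E G b v → HamiltonianDel G (Del₁ G v)

-- A hamiltonian cycle of H - u - v (H the amalgam, uv an edge) is assembled from hamiltonian
-- paths of the two sides, joined through the shared vertices a, a' and the new edges b₁b₂, b₁b₂',
-- b₁'b₂.  Since b has degree 3 with neighbours a, b', x, a hamiltonian cycle through b uses exactly
-- two of these; for each hypothesis this pair is forced, which yields six cycles per side with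
-- known behaviour at b (or at a, which also has degree 3).  For an edge uv inside G₁ with b ∉ {u, v},
-- the cycle of G₁ - u - v given by K₂-hamiltonicity leaves b along one of three pairs, and each pair
-- is completed by a suitable cycle of G₂; the edges at b₁ and the new edges are handled by the
-- cycles of G_i - v for v ∈ N[b_i] and of G_i - a_i'.  The remaining edges follow by exchanging
-- the roles of the two tuples.

module Submission where

open import Defs
open import Data.Nat using (_≤_; z≤n; s≤s; s≤s⁻¹)
open import Data.Product using (Σ-syntax; ∃₂; ∃-syntax; _×_; _,_; proj₁; proj₂)
open import Data.Sum using (_⊎_; inj₁; inj₂; [_,_]′)
import Data.Sum
open import Data.Sum.Properties using (inj₁-injective)
open import Data.Bool using (T)
open import Data.Bool.Properties using (T-irrelevant)
open import Data.Empty using (⊥-elim)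
open import Data.List using (List; []; _∷_; _++_; [_]; zip; drop; length; map; reverse)
open import Data.List.Properties using (++-assoc; ++-identityʳ; length-map; unfold-reverse)
open import Data.List.Membership.Propositional using (_∈_; _∉_)
open import Data.List.Membership.Propositional.Properties using (∈-∃++; ∈-map⁺; ∈-map⁻; ∈-++⁺ˡ; ∈-++⁺ʳ)
open import Data.List.Relation.Unary.All as All using (All; []; _∷_)
import Data.List.Relation.Unary.All.Properties as Allₚ
open import Data.List.Relation.Unary.Any as Any using (Any; here; there)
open import Data.List.Relation.Unary.Unique.Propositional using (Unique)
open import Data.List.Relation.Unary.AllPairs as AllPairs using ([]; _∷_)
import Data.List.Relation.Unary.Unique.Propositional.Properties as Uniqueₚ
open Uniqueₚ using (Unique[x∷xs]⇒x∉xs)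
open import Data.List.Relation.Binary.Permutation.Propositional
  using (_↭_; ↭-sym; ↭-refl; ↭⇒↭ₛ; prep; swap; module PermutationReasoning)
open import Data.List.Relation.Binary.Permutation.Propositional.Properties
  using (All-resp-↭; Any-resp-↭; ∈-resp-↭; ↭-length; ++-comm; ↭-reverse; ∷↭∷ʳ; shift)
import Data.List.Relation.Binary.Permutation.Setoid.Properties as PermutationSetoid
open import Relation.Nullary using (¬_; yes; no)
open import Relation.Binary.PropositionalEquality using (_≡_; _≢_; refl; sym; trans; cong; subst; setoid)
open import Function.Base using (_∘_; id)
open import Function.Bundles using (_⇔_; mk⇔; Equivalence)

Unique-resp-↭ : {A : Set} {xs ys : List A} → xs ↭ ys → Unique xs → Unique ys
Unique-resp-↭ {A} p = PermutationSetoid.Unique-resp-↭ (setoid A) (↭⇒↭ₛ p)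

data Walk {A : Set} (R : A → A → Set) : A → List A → A → Set where
  stop : ∀ {x} → Walk R x [ x ] x
  step : ∀ {x y l z} → R x y → Walk R y l z → Walk R x (x ∷ l) z

module _ {A : Set} {R : A → A → Set} where

  walk-++ : ∀ {x l y z m w} → Walk R x l y → R y z → Walk R z m w → Walk R x (l ++ m) w
  walk-++ stop       e q = step e q
  walk-++ (step f p) e q = step f (walk-++ p e q)

  walk-∷ʳ : ∀ {x l y z} → Walk R x l y → R y z → Walk R x (l ++ [ z ]) z
  walk-∷ʳ p e = walk-++ p e stop

  walk-reverse : (∀ {u w} → R u w → R w u) → ∀ {x l y} → Walk R x l y → Walk R y (reverse l) x
  walk-reverse R-sym stop = stop
  walk-reverse R-sym {x} (step {l = l} e p) rewrite unfold-reverse x l =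
    walk-∷ʳ (walk-reverse R-sym p) (R-sym e)

  walk-start-∈ : ∀ {x l y} → Walk R x l y → x ∈ l
  walk-start-∈ stop       = here refl
  walk-start-∈ (step _ _) = here refl

  walk-end-∈ : ∀ {x l y} → Walk R x l y → y ∈ l
  walk-end-∈ stop       = here refl
  walk-end-∈ (step _ p) = there (walk-end-∈ p)

  walk-cons : ∀ {x l y} → Walk R x l y → ∃[ l' ] l ≡ x ∷ l'
  walk-cons stop       = [] , refl
  walk-cons (step _ _) = _ , refl

  walk-uncons : ∀ {x l y} → Walk R x l y → x ≢ y → ∃₂ λ z m → l ≡ x ∷ m × R x z × Walk R z m y
  walk-uncons stop       x≢y = ⊥-elim (x≢y refl)
  walk-uncons (step e p) _   = _ , _ , refl , e , p

  walk-ends-distinct : ∀ {x l y} → Walk R x l y → Unique l → 2 ≤ length l → x ≢ y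
  walk-ends-distinct stop _ (s≤s ())
  walk-ends-distinct (step _ p) (x∉ ∷ _) _ refl = All.lookup x∉ (walk-end-∈ p) refl

  walk-long : ∀ {x l y z m w} → Walk R x l y → x ≢ y → Walk R z m w → 3 ≤ length (l ++ m)
  walk-long stop       x≢y _ = ⊥-elim (x≢y refl)
  walk-long (step _ stop)       _ q with walk-cons q
  ... | _ , refl = s≤s (s≤s (s≤s z≤n))
  walk-long (step _ (step _ p)) _ _ with walk-cons p
  ... | _ , refl = s≤s (s≤s (s≤s z≤n))

  walk-interior : ∀ {s l t u} → Walk R s l t → Unique l → u ∈ l → u ≢ s → u ≢ t →
                  ∃₂ λ p q → p ∈ l × q ∈ l × p ≢ q × R p u × R u q
  walk-interior stop _ (here refl) u≢s _ = ⊥-elim (u≢s refl)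
  walk-interior (step _ _) _ (here refl) u≢s _ = ⊥-elim (u≢s refl)
  walk-interior (step _ stop) _ (there (here refl)) _ u≢t = ⊥-elim (u≢t refl)
  walk-interior (step e (step f p)) (s∉ ∷ _) (there (here refl)) _ _ =
    _ , _ , here refl , there (there (walk-start-∈ p)) ,
    (λ { refl → All.lookup s∉ (there (walk-start-∈ p)) refl }) , e , f
  walk-interior (step _ p@(step _ _)) (_ ∷ uq@(y∉ ∷ _)) (there (there u∈)) _ u≢t
    with walk-interior p uq (there u∈) (λ { refl → All.lookup y∉ u∈ refl }) u≢t
  ... | p' , q' , p'∈ , q'∈ , p'≢q' , r₁ , r₂ = p' , q' , there p'∈ , there q'∈ , p'≢q' , r₁ , r₂

walk-map : ∀ {A B : Set} {R : A → A → Set} {S : B → B → Set} (f : A → B) →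
           (∀ {u w} → R u w → S (f u) (f w)) → ∀ {x l y} → Walk R x l y → Walk S (f x) (map f l) (f y)
walk-map f hom stop       = stop
walk-map f hom (step e p) = step (hom e) (walk-map f hom p)

walk-restrict : ∀ {A : Set} {R S : A → A → Set} (P : A → Set) →
                (∀ {u w} → P u → P w → R u w → S u w) → ∀ {x l y} → All P l → Walk R x l y → Walk S x l y
walk-restrict P sub (_ ∷ [])            stop       = stop
walk-restrict P sub (Px ∷ Pl@(Py ∷ _)) (step e p) with walk-cons p
... | _ , refl = step (sub Px Py e) (walk-restrict P sub Pl p)

module _ {A : Set} where

  Pair : A → A → A × A → Set
  Pair p q e = SamePair (proj₁ e) (proj₂ e) p q

  -- cyclePairs (x ∷ l) is pairsTo (x ∷ l) x
  pairsTo : List A → A → List (A × A)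
  pairsTo l z = zip l (drop 1 l ++ [ z ])

module _ {A : Set} {R : A → A → Set} where

  walk-pairsTo : ∀ {x l y z} → Walk R x l y → R y z →
                 All (λ e → R (proj₁ e) (proj₂ e)) (pairsTo l z)
  walk-pairsTo stop                e = e ∷ []
  walk-pairsTo (step f stop)       e = f ∷ e ∷ []
  walk-pairsTo (step f p@(step _ _)) e = f ∷ walk-pairsTo p e

  pairsTo-walk : ∀ x l z → All (λ e → R (proj₁ e) (proj₂ e)) (pairsTo (x ∷ l) z) →
                 ∃[ y ] Walk R x (x ∷ l) y × R y z
  pairsTo-walk x []      z (e ∷ [])  = x , stop , e
  pairsTo-walk x (y ∷ l) z (f ∷ es) with pairsTo-walk y l z es
  ... | w , p , e = w , step f p , e

  pairsTo-end : ∀ {s l t v w} → Walk R s l t → v ∉ l →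
                Any (Pair v w) (pairsTo l v) → w ≡ t
  pairsTo-end stop v∉ (here (inj₁ (refl , _))) = ⊥-elim (v∉ (here refl))
  pairsTo-end stop v∉ (here (inj₂ (refl , _))) = refl
  pairsTo-end (step _ stop) v∉ (here (inj₁ (refl , _))) = ⊥-elim (v∉ (here refl))
  pairsTo-end (step _ stop) v∉ (here (inj₂ (_ , refl))) = ⊥-elim (v∉ (there (here refl)))
  pairsTo-end (step _ stop) v∉ (there a) = pairsTo-end stop (λ v∈ → v∉ (there v∈)) a
  pairsTo-end (step _ (step _ p)) v∉ (here (inj₁ (refl , _))) = ⊥-elim (v∉ (here refl))
  pairsTo-end (step _ (step _ p)) v∉ (here (inj₂ (_ , refl))) = ⊥-elim (v∉ (there (here refl)))
  pairsTo-end (step _ q@(step _ _)) v∉ (there a) = pairsTo-end q (λ v∈ → v∉ (there v∈)) a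

  end-pairsTo : ∀ {s l t v} → Walk R s l t → Any (Pair v t) (pairsTo l v)
  end-pairsTo stop                  = here (inj₂ (refl , refl))
  end-pairsTo (step _ stop)         = there (here (inj₂ (refl , refl)))
  end-pairsTo (step _ q@(step _ _)) = there (end-pairsTo q)

module _ {A : Set} where

  pairsTo-∷ʳ : ∀ (y : A) l x w → pairsTo ((y ∷ l) ++ [ x ]) w ≡ pairsTo (y ∷ l) x ++ [ (x , w) ]
  pairsTo-∷ʳ y []      x w = refl
  pairsTo-∷ʳ y (z ∷ l) x w = cong ((y , z) ∷_) (pairsTo-∷ʳ z l x w)

  cyclePairs-rotate : (xs ys : List A) → cyclePairs (xs ++ ys) ↭ cyclePairs (ys ++ xs)
  cyclePairs-rotate [] ys rewrite ++-identityʳ ys = ↭-refl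
  cyclePairs-rotate (x ∷ xs) ys = begin
    cyclePairs (x ∷ xs ++ ys)         ↭⟨ rotate₁ x (xs ++ ys) ⟩
    cyclePairs ((xs ++ ys) ++ [ x ])  ≡⟨ cong cyclePairs (++-assoc xs ys [ x ]) ⟩
    cyclePairs (xs ++ ys ++ [ x ])    ↭⟨ cyclePairs-rotate xs (ys ++ [ x ]) ⟩
    cyclePairs ((ys ++ [ x ]) ++ xs)  ≡⟨ cong cyclePairs (++-assoc ys [ x ] xs) ⟩
    cyclePairs (ys ++ x ∷ xs)         ∎
    where
    open PermutationReasoning
    rotate₁ : ∀ x l → cyclePairs (x ∷ l) ↭ cyclePairs (l ++ [ x ])
    rotate₁ x []      = ↭-refl
    rotate₁ x (y ∷ l) rewrite pairsTo-∷ʳ y l x y = ∷↭∷ʳ (x , y) (pairsTo (y ∷ l) x)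

  CycleHasEdge-rotate : ∀ xs ys {p q : A} → CycleHasEdge (xs ++ ys) p q → CycleHasEdge (ys ++ xs) p q
  CycleHasEdge-rotate xs ys = Any-resp-↭ (cyclePairs-rotate xs ys)

record Enumerates {A : Set} (Y : A → Set) (L : List A) : Set where
  field
    unique : Unique L
    avoids : All (λ w → ¬ Y w) L
    covers : ∀ w → ¬ Y w → w ∈ L

module _ {A : Set} {Y : A → Set} where

  enumerates-↭ : ∀ {L L'} → L ↭ L' → Enumerates Y L → Enumerates Y L'
  enumerates-↭ σ e = record
    { unique = Unique-resp-↭ σ unique
    ; avoids = All-resp-↭ σ avoids
    ; covers = λ w w∉Y → ∈-resp-↭ σ (covers w w∉Y)
    }
    where open Enumerates e

  enumerates-tail : ∀ {s L} → Enumerates Y (s ∷ L) → Enumerates (λ w → Y w ⊎ w ≡ s) L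
  enumerates-tail e = record
    { unique = AllPairs.tail unique
    ; avoids = All.zipWith fresh (All.tail avoids , AllPairs.head unique)
    ; covers = λ w w∉ → Any.tail (w∉ ∘ inj₂) (covers w (w∉ ∘ inj₁))
    }
    where
    open Enumerates e
    fresh : ∀ {s w} → ¬ Y w × s ≢ w → ¬ (Y w ⊎ w ≡ s)
    fresh (w∉Y , _)   (inj₁ Yw)   = w∉Y Yw
    fresh (_   , s≢w) (inj₂ refl) = s≢w refl

module _ {A B : Set} {Y : A → Set} {Y' : B → Set} where

  enumerates-map : (f : A → B) → (∀ {x y} → f x ≡ f y → x ≡ y) → (∀ b → ∃[ a ] f a ≡ b) →
                   (∀ a → Y' (f a) → Y a) → (∀ a → Y a → Y' (f a)) →
                   ∀ {L} → Enumerates Y L → Enumerates Y' (map f L)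
  enumerates-map f inj surj Y'⇒Y Y⇒Y' e = record
    { unique = Uniqueₚ.map⁺ inj unique
    ; avoids = Allₚ.map⁺ (All.map (λ {a} a∉Y → a∉Y ∘ Y'⇒Y a) avoids)
    ; covers = λ b b∉Y' → cover (surj b) b∉Y'
    }
    where
    open Enumerates e
    cover : ∀ {b} → ∃[ a ] f a ≡ b → ¬ Y' b → b ∈ map f _
    cover (a , refl) b∉Y' = ∈-map⁺ f (covers a (b∉Y' ∘ Y⇒Y' a))

module _ {G : Graph} {X : V G → Set} where

  HamCycleDel-enumerates : ∀ {c} → HamCycleDel G X c → Enumerates X c
  HamCycleDel-enumerates C = record { unique = distinct ; avoids = avoids ; covers = covers }
    where open HamCycleDel C

  HamCycleDel-rotate : ∀ xs ys → HamCycleDel G X (xs ++ ys) → HamCycleDel G X (ys ++ xs)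
  HamCycleDel-rotate xs ys C = record
    { long     = subst (3 ≤_) (↭-length σ) long
    ; distinct = unique
    ; avoids   = avoids
    ; covers   = covers
    ; edges    = All-resp-↭ (cyclePairs-rotate xs ys) edges
    }
    where
    σ : xs ++ ys ↭ ys ++ xs
    σ = ++-comm xs ys
    open HamCycleDel C using (long; edges)
    open Enumerates (enumerates-↭ σ (HamCycleDel-enumerates C))

  closed-walk⇒ham : ∀ {s L t} → Walk (E G) s L t → E G t s → 3 ≤ length L → Enumerates X L →
                    HamiltonianDel G X
  closed-walk⇒ham p ts long e with walk-cons p
  ... | _ , refl = _ , record
    { long = long ; distinct = unique ; avoids = avoids ; covers = covers ; edges = walk-pairsTo p ts }
    where open Enumerates e

module _ {G : Graph} where

  Del₂-sym : ∀ {u v} → HamiltonianDel G (Del₂ G u v) → HamiltonianDel G (Del₂ G v u)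
  Del₂-sym (c , C) = c , record
    { long     = long
    ; distinct = distinct
    ; avoids   = All.map (_∘ Data.Sum.swap) avoids
    ; covers   = λ w → covers w ∘ (_∘ Data.Sum.swap)
    ; edges    = edges
    }
    where open HamCycleDel C

  Del₂-pair : ∀ {u v p q} → SamePair u v p q →
              HamiltonianDel G (Del₂ G p q) → HamiltonianDel G (Del₂ G u v)
  Del₂-pair (inj₁ (refl , refl)) = id
  Del₂-pair (inj₂ (refl , refl)) = Del₂-sym

ham-map : ∀ {G G'} (φ : V G → V G') → (∀ {u w} → φ u ≡ φ w → u ≡ w) → (∀ w' → ∃[ w ] φ w ≡ w') →
          (∀ {u w} → E G u w → E G' (φ u) (φ w)) →
          ∀ {u v} → HamiltonianDel G (Del₂ G u v) → HamiltonianDel G' (Del₂ G' (φ u) (φ v))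
ham-map φ inj surj hom ([] , C) with HamCycleDel.long C
... | ()
ham-map φ inj surj hom (c ∷ cs , C) with pairsTo-walk c cs c (HamCycleDel.edges C)
... | _ , p , tc = closed-walk⇒ham (walk-map φ hom p) (hom tc)
  (subst (3 ≤_) (sym (length-map φ (c ∷ cs))) (HamCycleDel.long C))
  (enumerates-map φ inj surj (λ _ → Data.Sum.map inj inj) (λ _ → Data.Sum.map (cong φ) (cong φ))
    (HamCycleDel-enumerates C))

-- A hamiltonian cycle of G - X traversing s, v, t consecutively; rest runs from s to t.
record HamCycleVia (G : Graph) (X : V G → Set) (v s t : V G) : Set where
  field
    rest       : List (V G)
    path       : Walk (E G) s rest t
    vs         : E G v s
    tv         : E G t v
    s≢t        : s ≢ t
    enumerates : Enumerates X (v ∷ rest)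

module _ {G : Graph} {X : V G → Set} where

  via-reverse : ∀ {v s t} → HamCycleVia G X v s t → HamCycleVia G X v t s
  via-reverse {v} C = record
    { rest       = reverse rest
    ; path       = walk-reverse (E-sym G) path
    ; vs         = E-sym G tv
    ; tv         = E-sym G vs
    ; s≢t        = λ t≡s → s≢t (sym t≡s)
    ; enumerates = enumerates-↭ (prep v (↭-sym (↭-reverse rest))) enumerates
    }
    where open HamCycleVia C

  via-orient : ∀ {v s t p q} → HamCycleVia G X v s t → SamePair s t p q → HamCycleVia G X v p q
  via-orient C (inj₁ (refl , refl)) = C
  via-orient C (inj₂ (refl , refl)) = via-reverse C

  via-start-avoids : ∀ {v s t} → HamCycleVia G X v s t → ¬ X s
  via-start-avoids C =
    All.lookup (Enumerates.avoids (HamCycleVia.enumerates C)) (there (walk-start-∈ (HamCycleVia.path C)))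

  via-end-avoids : ∀ {v s t} → HamCycleVia G X v s t → ¬ X t
  via-end-avoids C =
    All.lookup (Enumerates.avoids (HamCycleVia.enumerates C)) (there (walk-end-∈ (HamCycleVia.path C)))

  rooted : ∀ {v l} → HamCycleDel G X (v ∷ l) →
           ∃₂ λ s t → HamCycleVia G X v s t × (∀ {w} → CycleHasEdge (v ∷ l) v w ⇔ (w ≡ s ⊎ w ≡ t))
  rooted {v} {l} C with pairsTo-walk v l v (HamCycleDel.edges C)
  ... | _ , stop , _ with HamCycleDel.long C
  ...   | s≤s ()
  rooted C | _ , step _ stop , _ with HamCycleDel.long C
  ...   | s≤s (s≤s ())
  rooted {v} {l} C | t , step {y = s} vs p@(step _ _) , tv = s , t , via , mk⇔ to from
    where
    open HamCycleDel C using (long; distinct)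
    v∉ : v ∉ l
    v∉ = Unique[x∷xs]⇒x∉xs distinct
    via : HamCycleVia G X v s t
    via = record
      { rest = l ; path = p ; vs = vs ; tv = tv ; enumerates = HamCycleDel-enumerates C
      ; s≢t = walk-ends-distinct p (AllPairs.tail distinct) (s≤s⁻¹ long) }
    to : ∀ {w} → CycleHasEdge (v ∷ l) v w → w ≡ s ⊎ w ≡ t
    to (here (inj₁ (_ , refl))) = inj₁ refl
    to (here (inj₂ (_ , refl))) = ⊥-elim (v∉ (here refl))
    to (there a)                = inj₂ (pairsTo-end p v∉ a)
    from : ∀ {w} → w ≡ s ⊎ w ≡ t → CycleHasEdge (v ∷ l) v w
    from (inj₁ refl) = here (inj₁ (refl , refl))
    from (inj₂ refl) = there (end-pairsTo p)

  through : ∀ {c v} → HamCycleDel G X c → ¬ X v →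
            ∃₂ λ s t → HamCycleVia G X v s t × (∀ {w} → CycleHasEdge c v w ⇔ (w ≡ s ⊎ w ≡ t))
  through C v∉X with ∈-∃++ (HamCycleDel.covers C _ v∉X)
  ... | pre , post , refl with rooted (HamCycleDel-rotate pre (_ ∷ post) C)
  ... | s , t , via , edge⇔ = s , t , via , mk⇔
    (Equivalence.to edge⇔ ∘ CycleHasEdge-rotate pre (_ ∷ post))
    (CycleHasEdge-rotate (_ ∷ post) pre ∘ Equivalence.from edge⇔)

  via-drop-start : ∀ {v s t} → HamCycleVia G X v s t →
                   ∃₂ λ z m → E G s z × Walk (E G) z m t × Enumerates (λ w → X w ⊎ w ≡ s) (v ∷ m)
  via-drop-start {v} {s} C with walk-uncons (HamCycleVia.path C) (HamCycleVia.s≢t C)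
  ... | z , m , refl , sz , p =
    z , m , sz , p , enumerates-tail (enumerates-↭ (swap v s ↭-refl) (HamCycleVia.enumerates C))

  via-root-∉ : ∀ {v s t} (C : HamCycleVia G X v s t) → v ∉ HamCycleVia.rest C
  via-root-∉ C = Unique[x∷xs]⇒x∉xs (Enumerates.unique (HamCycleVia.enumerates C))

  via-deleted-∉ : ∀ {v s t w} (C : HamCycleVia G X v s t) → X w → w ∉ HamCycleVia.rest C
  via-deleted-∉ C Xw w∈ = All.lookup (Enumerates.avoids (HamCycleVia.enumerates C)) (there w∈) Xw

  via-rest-∈ : ∀ {v s t w} (C : HamCycleVia G X v s t) → ¬ X w → w ≢ v → w ∈ HamCycleVia.rest C
  via-rest-∈ C w∉X w≢v = Any.tail w≢v (Enumerates.covers (HamCycleVia.enumerates C) _ w∉X)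

-- Vertices of degree three

ends-pair : ∀ {A : Set} {s t p q : A} → p ≡ s ⊎ p ≡ t → q ≡ s ⊎ q ≡ t → p ≢ q → SamePair s t p q
ends-pair (inj₁ refl) (inj₁ refl) p≢q = ⊥-elim (p≢q refl)
ends-pair (inj₁ refl) (inj₂ refl) _   = inj₁ (refl , refl)
ends-pair (inj₂ refl) (inj₁ refl) _   = inj₂ (refl , refl)
ends-pair (inj₂ refl) (inj₂ refl) p≢q = ⊥-elim (p≢q refl)

record Nbhd₃ (G : Graph) (v x y z : V G) : Set where
  field
    x≢y  : x ≢ y
    x≢z  : x ≢ z
    y≢z  : y ≢ z
    vx   : E G v x
    vy   : E G v y
    vz   : E G v z
    only : ∀ w → E G v w → w ≡ x ⊎ w ≡ y ⊎ w ≡ z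

module _ {G : Graph} where

  nbhd₃-swap₁₂ : ∀ {v x y z} → Nbhd₃ G v x y z → Nbhd₃ G v y x z
  nbhd₃-swap₁₂ N = record
    { x≢y = x≢y ∘ sym ; x≢z = y≢z ; y≢z = x≢z ; vx = vy ; vy = vx ; vz = vz
    ; only = λ w e → [ inj₂ ∘ inj₁ , [ inj₁ , inj₂ ∘ inj₂ ]′ ]′ (only w e) }
    where open Nbhd₃ N

  nbhd₃-swap₂₃ : ∀ {v x y z} → Nbhd₃ G v x y z → Nbhd₃ G v x z y
  nbhd₃-swap₂₃ N = record
    { x≢y = x≢z ; x≢z = x≢y ; y≢z = y≢z ∘ sym ; vx = vx ; vy = vz ; vz = vy
    ; only = λ w e → Data.Sum.map₂ Data.Sum.swap (only w e) }
    where open Nbhd₃ N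

  degree-3-nbhd : ∀ {v} → HasDegree G v 3 → ∃₂ λ x y → ∃[ z ] Nbhd₃ G v x y z
  degree-3-nbhd (x ∷ y ∷ z ∷ [] , refl , (x≢y ∷ x≢z ∷ []) ∷ (y≢z ∷ []) ∷ [] ∷ [] , adj) =
    x , y , z , record
      { x≢y = x≢y ; x≢z = x≢z ; y≢z = y≢z
      ; vx = from (adj x) (here refl) ; vy = from (adj y) (there (here refl))
      ; vz = from (adj z) (there (there (here refl)))
      ; only = λ w e → one-of-three (to (adj w) e) }
    where
    open Equivalence
    one-of-three : ∀ {w} → w ∈ x ∷ y ∷ z ∷ [] → w ≡ x ⊎ w ≡ y ⊎ w ≡ z
    one-of-three (here w≡x)                 = inj₁ w≡x
    one-of-three (there (here w≡y))         = inj₂ (inj₁ w≡y)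
    one-of-three (there (there (here w≡z))) = inj₂ (inj₂ w≡z)

  nbhd₃-complete : ∀ {v x y z p q} → Nbhd₃ G v x y z → E G v p → E G v q → p ≢ q → ∃[ r ] Nbhd₃ G v p q r
  nbhd₃-complete {p = p} {q} N vp vq p≢q with Nbhd₃.only N p vp | Nbhd₃.only N q vq
  ... | inj₁ refl        | inj₁ refl        = ⊥-elim (p≢q refl)
  ... | inj₂ (inj₁ refl) | inj₂ (inj₁ refl) = ⊥-elim (p≢q refl)
  ... | inj₂ (inj₂ refl) | inj₂ (inj₂ refl) = ⊥-elim (p≢q refl)
  ... | inj₁ refl        | inj₂ (inj₁ refl) = _ , N
  ... | inj₂ (inj₁ refl) | inj₁ refl        = _ , nbhd₃-swap₁₂ N
  ... | inj₁ refl        | inj₂ (inj₂ refl) = _ , nbhd₃-swap₂₃ N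
  ... | inj₂ (inj₂ refl) | inj₁ refl        = _ , nbhd₃-swap₁₂ (nbhd₃-swap₂₃ N)
  ... | inj₂ (inj₁ refl) | inj₂ (inj₂ refl) = _ , nbhd₃-swap₂₃ (nbhd₃-swap₁₂ N)
  ... | inj₂ (inj₂ refl) | inj₂ (inj₁ refl) = _ , nbhd₃-swap₂₃ (nbhd₃-swap₁₂ (nbhd₃-swap₂₃ N))

  degree-3 : ∀ {v p q} → HasDegree G v 3 → E G v p → E G v q → p ≢ q → ∃[ r ] Nbhd₃ G v p q r
  degree-3 deg with degree-3-nbhd deg
  ... | _ , _ , _ , N = nbhd₃-complete N

  module _ {X : V G → Set} where

    via-nbhd₃ : ∀ {v x y z s t} → Nbhd₃ G v x y z → HamCycleVia G X v s t → s ≢ z → t ≢ z →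
                HamCycleVia G X v x y
    via-nbhd₃ {s = s} {t} N C s≢z t≢z
      with Nbhd₃.only N s (HamCycleVia.vs C) | Nbhd₃.only N t (E-sym G (HamCycleVia.tv C))
    ... | inj₂ (inj₂ s≡z) | _                = ⊥-elim (s≢z s≡z)
    ... | _               | inj₂ (inj₂ t≡z) = ⊥-elim (t≢z t≡z)
    ... | inj₁ refl        | inj₂ (inj₁ refl) = C
    ... | inj₂ (inj₁ refl) | inj₁ refl        = via-reverse C
    ... | inj₁ refl        | inj₁ refl        = ⊥-elim (HamCycleVia.s≢t C refl)
    ... | inj₂ (inj₁ refl) | inj₂ (inj₁ refl) = ⊥-elim (HamCycleVia.s≢t C refl)

    via-nbhd₃-cases : ∀ {v x y z s t} → Nbhd₃ G v x y z → HamCycleVia G X v s t →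
                      HamCycleVia G X v x y ⊎ HamCycleVia G X v x z ⊎ HamCycleVia G X v y z
    via-nbhd₃-cases {s = s} {t} N C
      with Nbhd₃.only N s (HamCycleVia.vs C) | Nbhd₃.only N t (E-sym G (HamCycleVia.tv C))
    ... | inj₁ refl        | inj₂ (inj₁ refl) = inj₁ C
    ... | inj₂ (inj₁ refl) | inj₁ refl        = inj₁ (via-reverse C)
    ... | inj₁ refl        | inj₂ (inj₂ refl) = inj₂ (inj₁ C)
    ... | inj₂ (inj₂ refl) | inj₁ refl        = inj₂ (inj₁ (via-reverse C))
    ... | inj₂ (inj₁ refl) | inj₂ (inj₂ refl) = inj₂ (inj₂ C)
    ... | inj₂ (inj₂ refl) | inj₂ (inj₁ refl) = inj₂ (inj₂ (via-reverse C))
    ... | inj₁ refl        | inj₁ refl        = ⊥-elim (HamCycleVia.s≢t C refl)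
    ... | inj₂ (inj₁ refl) | inj₂ (inj₁ refl) = ⊥-elim (HamCycleVia.s≢t C refl)
    ... | inj₂ (inj₂ refl) | inj₂ (inj₂ refl) = ⊥-elim (HamCycleVia.s≢t C refl)

    -- u has at most one neighbour on the path, so it cannot be an interior vertex of it.
    nbhd₃-off-cycle : ∀ {u x y z v s t} → Nbhd₃ G u x y z → (C : HamCycleVia G X v s t) →
                      u ∈ HamCycleVia.rest C → x ∉ HamCycleVia.rest C → y ∉ HamCycleVia.rest C →
                      u ≡ s ⊎ u ≡ t
    nbhd₃-off-cycle {u} {s = s} {t} N C u∈ x∉ y∉ with _≟_ G u s | _≟_ G u t
    ... | yes u≡s | _       = inj₁ u≡s
    ... | no _    | yes u≡t = inj₂ u≡t
    ... | no u≢s  | no u≢t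
      with walk-interior (HamCycleVia.path C) (AllPairs.tail (Enumerates.unique (HamCycleVia.enumerates C)))
                         u∈ u≢s u≢t
    ... | p , q , p∈ , q∈ , p≢q , pu , uq =
      ⊥-elim (p≢q (trans (is-z p∈ (E-sym G pu)) (sym (is-z q∈ uq))))
      where
      is-z : ∀ {w} → w ∈ HamCycleVia.rest C → E G u w → w ≡ _
      is-z {w} w∈ uw with Nbhd₃.only N w uw
      ... | inj₁ refl        = ⊥-elim (x∉ w∈)
      ... | inj₂ (inj₁ refl) = ⊥-elim (y∉ w∈)
      ... | inj₂ (inj₂ w≡z)  = w≡z

module Piece (T : Tuple) where
  open Tuple T public
  open Gluing glue public

  Kept : V G → V G → Set
  Kept u w = E G u w × ¬ SamePair u w a b × ¬ SamePair u w b b'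

  kept-sym : ∀ {u w} → Kept u w → Kept w u
  kept-sym (uw , ¬ab , ¬bb') = E-sym G uw , ¬ab ∘ flip , ¬bb' ∘ flip
    where
    flip : ∀ {u w p q : V G} → SamePair w u p q → SamePair u w p q
    flip (inj₁ (w≡p , u≡q)) = inj₂ (u≡q , w≡p)
    flip (inj₂ (w≡q , u≡p)) = inj₁ (u≡p , w≡q)

  kept : ∀ {u w} → u ≢ b → w ≢ b → E G u w → Kept u w
  kept u≢b w≢b uw = uw , [ w≢b ∘ proj₂ , u≢b ∘ proj₁ ]′ , [ u≢b ∘ proj₁ , w≢b ∘ proj₂ ]′

  kept-walk : ∀ {u l w} → b ∉ l → Walk (E G) u l w → Walk Kept u l w
  kept-walk b∉ = walk-restrict (_≢ b) kept (Allₚ.¬Any⇒All¬ _ (b∉ ∘ Any.map sym))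

  N-b : ∃[ x ] Nbhd₃ G b x b' a
  N-b = Data.Product.map₂ (nbhd₃-swap₁₂ ∘ nbhd₃-swap₂₃ ∘ nbhd₃-swap₁₂)
                          (degree-3 deg-b (E-sym G ab) bb' a≢b')

  N-a : ∃[ y ] Nbhd₃ G a a' b y
  N-a = degree-3 deg-a aa' ab a'≢b

  x : V G
  x = proj₁ N-b

  y : V G
  y = proj₁ N-a

  kept-b : ∀ {z} → E G b z → z ≢ a → z ≢ b' → Kept b z
  kept-b bz z≢a z≢b' = bz , [ a≢b ∘ sym ∘ proj₁ , z≢a ∘ proj₂ ]′ , [ z≢b' ∘ proj₂ , b≢b' ∘ proj₁ ]′

  kept-a : ∀ {z} → E G a z → z ≢ b → Kept a z
  kept-a az z≢b = az , [ z≢b ∘ proj₂ , a≢b ∘ proj₁ ]′ , [ a≢b ∘ proj₁ , a≢b' ∘ proj₁ ]′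

  kept-bx : Kept b x
  kept-bx = kept-b vx x≢z x≢y
    where open Nbhd₃ (proj₂ N-b)

  kept-from-b : ∀ {w} → Kept b w → w ≡ x
  kept-from-b {w} (bw , ¬ab , ¬bb') with Nbhd₃.only (proj₂ N-b) w bw
  ... | inj₁ w≡x               = w≡x
  ... | inj₂ (inj₁ refl)       = ⊥-elim (¬bb' (inj₁ (refl , refl)))
  ... | inj₂ (inj₂ refl)       = ⊥-elim (¬ab (inj₂ (refl , refl)))

  module _ {X : V G → Set} {s t : V G} (C : HamCycleVia G X b s t) where

    rest-walk : Walk Kept s (HamCycleVia.rest C) t
    rest-walk = kept-walk (via-root-∉ C) (HamCycleVia.path C)

    root-walk : Kept b s → Walk Kept b (b ∷ HamCycleVia.rest C) t
    root-walk bs = step bs rest-walk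

module Gadgets (T : Tuple) (C : Conditions T) where
  open Piece T
  open Conditions C

  private
    Nb : Nbhd₃ G b x b' a
    Nb = proj₂ N-b
    Na : Nbhd₃ G a a' b y
    Na = proj₂ N-a

  cycle-aa' : HamCycleVia G (Del₂ G a a') b x b'
  cycle-aa' with k2ham a a' aa'
  ... | _ , H with through H [ a≢b ∘ sym , a'≢b ∘ sym ]′
  ... | _ , _ , V , _ =
    via-nbhd₃ Nb V (via-start-avoids V ∘ inj₁) (via-end-avoids V ∘ inj₁)

  cycle-a'-bb' : HamCycleVia G (Del₁ G a') b b' a
  cycle-a'-bb' with with-bb'
  ... | _ , H , bb'∈H with through H (a'≢b ∘ sym)
  ... | s , t , V , edge⇔ = via-orient V (ends-pair (Equivalence.to edge⇔ bb'∈H) a-end (a≢b' ∘ sym))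
    where
    a-end : a ≡ s ⊎ a ≡ t
    a-end = nbhd₃-off-cycle Na V (via-rest-∈ V a≢a' a≢b) (via-deleted-∉ V refl) (via-root-∉ V)

  cycle-a'-bx : HamCycleVia G (Del₁ G a') b a x
  cycle-a'-bx with without-bb'
  ... | _ , H , bb'∉H with through H (a'≢b ∘ sym)
  ... | _ , _ , V , edge⇔ = via-nbhd₃ (nbhd₃-swap₁₂ (nbhd₃-swap₂₃ Nb)) V
    (λ { refl → bb'∉H (Equivalence.from edge⇔ (inj₁ refl)) })
    (λ { refl → bb'∉H (Equivalence.from edge⇔ (inj₂ refl)) })

  cycle-b : HamCycleVia G (Del₁ G b) a a' y
  cycle-b with closedNbhd b (inj₁ refl)
  ... | _ , H with through H a≢b
  ... | _ , _ , V , _ = via-nbhd₃ (nbhd₃-swap₂₃ Na) V (via-start-avoids V) (via-end-avoids V)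

  cycle-b' : HamCycleVia G (Del₁ G b') b a x
  cycle-b' with closedNbhd b' (inj₂ bb')
  ... | _ , H with through H b≢b'
  ... | _ , _ , V , _ =
    via-nbhd₃ (nbhd₃-swap₁₂ (nbhd₃-swap₂₃ Nb)) V (via-start-avoids V) (via-end-avoids V)

  cycle-x : HamCycleVia G (Del₁ G x) b b' a
  cycle-x with closedNbhd x (inj₂ (Nbhd₃.vx Nb))
  ... | _ , H with through H (λ b≡x → E-irr G (subst (E G b) (sym b≡x) (Nbhd₃.vx Nb)))
  ... | _ , _ , V , _ =
    via-nbhd₃ (nbhd₃-swap₂₃ (nbhd₃-swap₁₂ Nb)) V (via-start-avoids V) (via-end-avoids V)

-- Gluing the two sides

module Glue (T₁ T₂ : Tuple) where
  open Amalgam T₁ T₂ using (AV; V₂'; AE; ι₂; ι₂-inj; ι₂-inj₁; keep₂; keep-lemma; AE-sym)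
  module P₁ = Piece T₁
  module P₂ = Piece T₂
  open P₁ public using () renaming (G to G₁; a to a₁; a' to a₁'; b to b₁; b' to b₁'; x to x₁; y to y₁)
  open P₂ public using () renaming (G to G₂; a to a₂; a' to a₂'; b to b₂; b' to b₂'; x to x₂; y to y₂)

  H : Graph
  H = amalgam T₁ T₂

  ι₂-a : ι₂ a₂ ≡ inj₁ a₁
  ι₂-a with _≟_ G₂ a₂ a₂
  ... | yes _     = refl
  ... | no a₂≢a₂ = ⊥-elim (a₂≢a₂ refl)

  ι₂-a' : ι₂ a₂' ≡ inj₁ a₁'
  ι₂-a' with _≟_ G₂ a₂' a₂
  ... | yes a₂'≡a₂ = ⊥-elim (P₂.a≢a' (sym a₂'≡a₂))
  ... | no _ with _≟_ G₂ a₂' a₂'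
  ...   | yes _       = refl
  ...   | no a₂'≢a₂' = ⊥-elim (a₂'≢a₂' refl)

  ι₂-fresh : ∀ w → w ≢ a₂ → w ≢ a₂' → Σ[ u ∈ V₂' ] (ι₂ w ≡ inj₂ u × proj₁ u ≡ w)
  ι₂-fresh w w≢a₂ w≢a₂' with _≟_ G₂ w a₂
  ... | yes w≡a₂ = ⊥-elim (w≢a₂ w≡a₂)
  ... | no _ with _≟_ G₂ w a₂'
  ...   | yes w≡a₂' = ⊥-elim (w≢a₂' w≡a₂')
  ...   | no _      = _ , refl , refl

  kept₂-≢ : ∀ {w} → T (keep₂ w) → w ≢ a₂ × w ≢ a₂'
  kept₂-≢ {w} k with _≟_ G₂ w a₂ | _≟_ G₂ w a₂'
  ... | no w≢a₂ | no w≢a₂' = w≢a₂ , w≢a₂'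
  kept₂-≢ () | yes _ | _
  kept₂-≢ () | no _  | yes _

  ι₂-kept : ∀ w (k : T (keep₂ w)) → ι₂ w ≡ inj₂ (w , k)
  ι₂-kept w k with ι₂-fresh w (proj₁ (kept₂-≢ k)) (proj₂ (kept₂-≢ k))
  ... | (.w , k') , eq , refl = trans eq (cong (λ k'' → inj₂ (w , k'')) (T-irrelevant k' k))

  ι₂≡inj₁ : ∀ {w z} → ι₂ w ≡ inj₁ z → (w ≡ a₂ × z ≡ a₁) ⊎ (w ≡ a₂' × z ≡ a₁')
  ι₂≡inj₁ {w} {z} eq with ι₂-inj₁ w z eq
  ... | inj₁ refl = inj₁ (refl , inj₁-injective (trans (sym eq) ι₂-a))
  ... | inj₂ refl = inj₂ (refl , inj₁-injective (trans (sym eq) ι₂-a'))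

  ι₂-shared : ∀ {w z} → ι₂ w ≡ inj₁ z → w ≡ a₂ ⊎ w ≡ a₂'
  ι₂-shared eq = Data.Sum.map proj₁ proj₁ (ι₂≡inj₁ eq)

  edge₁ : ∀ {u w} → P₁.Kept u w → AE (inj₁ u) (inj₁ w)
  edge₁ e = inj₁ (_ , _ , refl , refl , e)

  edge₂ : ∀ {u w} → P₂.Kept u w → AE (ι₂ u) (ι₂ w)
  edge₂ e = inj₂ (inj₁ (_ , _ , refl , refl , e))

  walk₁ : ∀ {u l w} → Walk P₁.Kept u l w → Walk AE (inj₁ u) (map inj₁ l) (inj₁ w)
  walk₁ = walk-map inj₁ edge₁

  walk₂ : ∀ {u l w} → Walk P₂.Kept u l w → Walk AE (ι₂ u) (map ι₂ l) (ι₂ w)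
  walk₂ = walk-map ι₂ edge₂

  edge-a : ∀ {z} → P₂.Kept a₂ z → AE (inj₁ a₁) (ι₂ z)
  edge-a {z} e = subst (λ u → AE u (ι₂ z)) ι₂-a (edge₂ e)

  edge-a' : ∀ {z} → P₂.Kept a₂' z → AE (inj₁ a₁') (ι₂ z)
  edge-a' {z} e = subst (λ u → AE u (ι₂ z)) ι₂-a' (edge₂ e)

  edge-b₁b₂ : AE (inj₁ b₁) (ι₂ b₂)
  edge-b₁b₂ = inj₂ (inj₂ (inj₁ (inj₁ (refl , refl))))

  edge-b₁b₂' : AE (inj₁ b₁) (ι₂ b₂')
  edge-b₁b₂' = inj₂ (inj₂ (inj₂ (inj₁ (inj₁ (refl , refl)))))

  edge-b₁'b₂ : AE (inj₁ b₁') (ι₂ b₂)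
  edge-b₁'b₂ = inj₂ (inj₂ (inj₂ (inj₂ (inj₁ (refl , refl)))))

  -- H - X is split into the vertices of G₁ - Y₁ and those of G₂ - Y₂; the shared vertex a is
  -- taken from G₁, the shared vertex a' from G₁ or from G₂.
  record Split (X : AV → Set) (Y₁ : V G₁ → Set) (Y₂ : V G₂ → Set) : Set where
    field
      a₂-dropped : Y₂ a₂
      a'-once    : Y₁ a₁' ⊎ Y₂ a₂'
      deleted₁   : ∀ z → X (inj₁ z) → Y₁ z
      deleted₂   : ∀ w → X (ι₂ w) → Y₂ w
      present₁   : ∀ z → ¬ X (inj₁ z) → ¬ Y₁ z ⊎ (z ≡ a₁' × ¬ Y₂ a₂')
      present₂   : ∀ w → w ≢ a₂ → w ≢ a₂' → ¬ X (ι₂ w) → ¬ Y₂ w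

  split-enumerates : ∀ {X Y₁ Y₂ P Q} → Split X Y₁ Y₂ → Enumerates Y₁ P → Enumerates Y₂ Q →
                     Enumerates X (map inj₁ P ++ map ι₂ Q)
  split-enumerates {X} {Y₁} {Y₂} {P} {Q} S e₁ e₂ = record
    { unique = Uniqueₚ.++⁺ (Uniqueₚ.map⁺ inj₁-injective E₁.unique) (Uniqueₚ.map⁺ (ι₂-inj _ _) E₂.unique)
                           disjoint
    ; avoids = Allₚ.++⁺ (Allₚ.map⁺ (All.map (λ {z} ¬Y₁ → ¬Y₁ ∘ deleted₁ z) E₁.avoids))
                        (Allₚ.map⁺ (All.map (λ {w} ¬Y₂ → ¬Y₂ ∘ deleted₂ w) E₂.avoids))
    ; covers = cover
    }
    where
    open Split S
    module E₁ = Enumerates e₁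
    module E₂ = Enumerates e₂
    ∈Q : ∀ {w} → ¬ Y₂ w → ι₂ w ∈ map inj₁ P ++ map ι₂ Q
    ∈Q ¬Y₂ = ∈-++⁺ʳ (map inj₁ P) (∈-map⁺ ι₂ (E₂.covers _ ¬Y₂))
    disjoint : ∀ {u} → ¬ (u ∈ map inj₁ P × u ∈ map ι₂ Q)
    disjoint (u∈P , u∈Q) with ∈-map⁻ inj₁ u∈P | ∈-map⁻ ι₂ u∈Q
    ... | z , z∈P , refl | w , w∈Q , eq with ι₂≡inj₁ (sym eq)
    ...   | inj₁ (refl , _) = All.lookup E₂.avoids w∈Q a₂-dropped
    ...   | inj₂ (refl , refl) =
      [ All.lookup E₁.avoids z∈P , All.lookup E₂.avoids w∈Q ]′ a'-once
    cover : ∀ u → ¬ X u → u ∈ map inj₁ P ++ map ι₂ Q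
    cover (inj₁ z) ¬X with present₁ z ¬X
    ... | inj₁ ¬Y₁          = ∈-++⁺ˡ (∈-map⁺ inj₁ (E₁.covers z ¬Y₁))
    ... | inj₂ (refl , ¬Y₂) = subst (_∈ map inj₁ P ++ map ι₂ Q) ι₂-a' (∈Q ¬Y₂)
    cover (inj₂ (w , k)) ¬X with kept₂-≢ k
    ... | w≢a₂ , w≢a₂' = subst (_∈ map inj₁ P ++ map ι₂ Q) (ι₂-kept w k)
      (∈Q (present₂ w w≢a₂ w≢a₂' (¬X ∘ subst X (ι₂-kept w k))))

  glue : ∀ {X Y₁ Y₂ P Q x L y} → Split X Y₁ Y₂ → Enumerates Y₁ P → Enumerates Y₂ Q →
         Walk AE x L y → AE y x → 3 ≤ length L → L ↭ map inj₁ P ++ map ι₂ Q → HamiltonianDel H X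
  glue S e₁ e₂ p yx long σ =
    closed-walk⇒ham p yx long (enumerates-↭ (↭-sym σ) (split-enumerates S e₁ e₂))

  glue₂ : ∀ {X Y₁ Y₂ P Q p p' q q'} → Split X Y₁ Y₂ → Enumerates Y₁ P → Enumerates Y₂ Q →
          Walk P₁.Kept p P p' → p ≢ p' → AE (inj₁ p') (ι₂ q) →
          Walk P₂.Kept q Q q' → AE (ι₂ q') (inj₁ p) →
          HamiltonianDel H X
  glue₂ S e₁ e₂ p₁ p≢p' j p₂ cl = glue S e₁ e₂ (walk-++ (walk₁ p₁) j (walk₂ p₂)) cl
    (walk-long (walk₁ p₁) (p≢p' ∘ inj₁-injective) (walk₂ p₂)) ↭-refl

module Cases (T₁ T₂ : Tuple) (C₁ : Conditions T₁) (C₂ : Conditions T₂) where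
  open Glue T₁ T₂
  open Amalgam T₁ T₂ using (AE; AE-sym; ι₂; ι₂-inj)
  module Γ₁ = Gadgets T₁ C₁
  module Γ₂ = Gadgets T₂ C₂

  -- the path z ⋯ x₂ b₂ left of a cycle through a₂ b₂ x₂ by deleting a₂
  a-to-b₂ : ∀ {Y} → HamCycleVia G₂ Y b₂ a₂ x₂ →
            ∃₂ λ z Q → AE (inj₁ a₁) (ι₂ z) × Walk P₂.Kept z Q b₂ × Enumerates (λ w → Y w ⊎ w ≡ a₂) Q
  a-to-b₂ W with via-drop-start W
  ... | z , m , a₂z , p , e =
    z , m ++ [ b₂ ] , edge-a (P₂.kept-a a₂z z≢b₂) ,
    walk-∷ʳ (P₂.kept-walk b₂∉m p) (P₂.kept-sym P₂.kept-bx) , enumerates-↭ (∷↭∷ʳ b₂ m) e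
    where
    b₂∉m : b₂ ∉ m
    b₂∉m = Unique[x∷xs]⇒x∉xs (Enumerates.unique e)
    z≢b₂ : z ≢ b₂
    z≢b₂ refl = b₂∉m (walk-start-∈ p)

  split₁ : ∀ {u v Y₂} → (∀ w → w ≡ a₂ ⊎ w ≡ a₂' → Y₂ w) → (∀ w → Y₂ w → w ≡ a₂ ⊎ w ≡ a₂') →
           Split (Del₂ H (inj₁ u) (inj₁ v)) (Del₂ G₁ u v) Y₂
  split₁ to from = record
    { a₂-dropped = to _ (inj₁ refl)
    ; a'-once    = inj₂ (to _ (inj₂ refl))
    ; deleted₁   = λ _ → Data.Sum.map inj₁-injective inj₁-injective
    ; deleted₂   = λ w → to w ∘ [ ι₂-shared , ι₂-shared ]′
    ; present₁   = λ _ ¬X → inj₁ (¬X ∘ Data.Sum.map (cong inj₁) (cong inj₁))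
    ; present₂   = λ w w≢a₂ w≢a₂' _ → [ w≢a₂ , w≢a₂' ]′ ∘ from w
    }

  module _ {u v : V G₁} where

    side₁-x₁b₁' : HamCycleVia G₁ (Del₂ G₁ u v) b₁ x₁ b₁' → HamiltonianDel H (Del₂ H (inj₁ u) (inj₁ v))
    side₁-x₁b₁' C =
      glue₂ (split₁ (λ _ → id) (λ _ → id))
        (HamCycleVia.enumerates C) (HamCycleVia.enumerates Γ₂.cycle-aa')
        (P₁.root-walk C P₁.kept-bx) P₁.b≢b' edge-b₁'b₂
        (P₂.root-walk Γ₂.cycle-aa' P₂.kept-bx) (AE-sym edge-b₁b₂')

    side₁-x₁a₁ : HamCycleVia G₁ (Del₂ G₁ u v) b₁ x₁ a₁ → HamiltonianDel H (Del₂ H (inj₁ u) (inj₁ v))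
    side₁-x₁a₁ C with a-to-b₂ Γ₂.cycle-a'-bx
    ... | _ , _ , j , q , e =
      glue₂ (split₁ (λ _ → Data.Sum.swap) (λ _ → Data.Sum.swap)) (HamCycleVia.enumerates C) e
        (P₁.root-walk C P₁.kept-bx) (P₁.a≢b ∘ sym) j q (AE-sym edge-b₁b₂)

    -- the cycle b₁ b₂ b₁' ⋯ a₁ z ⋯ b₂' b₁, which alternates between the sides twice
    side₁-b₁'a₁ : HamCycleVia G₁ (Del₂ G₁ u v) b₁ b₁' a₁ → HamiltonianDel H (Del₂ H (inj₁ u) (inj₁ v))
    side₁-b₁'a₁ C with via-drop-start (via-reverse Γ₂.cycle-a'-bb')
    ... | z , m , a₂z , q , e =
      glue (split₁ (λ _ → Data.Sum.swap) (λ _ → Data.Sum.swap)) (HamCycleVia.enumerates C) e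
        (step edge-b₁b₂ (step (AE-sym edge-b₁'b₂) (walk-++ (walk₁ (P₁.rest-walk C)) j (walk₂ q'))))
        (AE-sym edge-b₁b₂') long
        (prep (inj₁ b₁) (↭-sym (shift (ι₂ b₂) (map inj₁ (HamCycleVia.rest C)) (map ι₂ m))))
      where
      b₂∉m : b₂ ∉ m
      b₂∉m = Unique[x∷xs]⇒x∉xs (Enumerates.unique e)
      q' : Walk P₂.Kept z m b₂'
      q' = P₂.kept-walk b₂∉m q
      j : AE (inj₁ a₁) (ι₂ z)
      j = edge-a (P₂.kept-a a₂z (λ { refl → b₂∉m (walk-start-∈ q) }))
      long : 3 ≤ length (inj₁ b₁ ∷ ι₂ b₂ ∷ map inj₁ (HamCycleVia.rest C) ++ map ι₂ m)
      long with walk-cons (HamCycleVia.path C)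
      ... | _ , eq rewrite eq = s≤s (s≤s (s≤s z≤n))

  side₁ : ∀ u v → u ≢ b₁ → v ≢ b₁ → HamiltonianDel G₁ (Del₂ G₁ u v) →
          HamiltonianDel H (Del₂ H (inj₁ u) (inj₁ v))
  side₁ u v u≢b₁ v≢b₁ (_ , K) with through K [ u≢b₁ ∘ sym , v≢b₁ ∘ sym ]′
  ... | _ , _ , C , _ with via-nbhd₃-cases (proj₂ P₁.N-b) C
  ... | inj₁ C-x₁b₁'        = side₁-x₁b₁' C-x₁b₁'
  ... | inj₂ (inj₁ C-x₁a₁)  = side₁-x₁a₁ C-x₁a₁
  ... | inj₂ (inj₂ C-b₁'a₁) = side₁-b₁'a₁ C-b₁'a₁

  delete-x₁b₁ : HamiltonianDel H (Del₂ H (inj₁ x₁) (inj₁ b₁))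
  delete-x₁b₁ with a-to-b₂ Γ₂.cycle-a'-bx
  ... | _ , _ , j , q , e =
    glue₂ (split₁ (λ _ → Data.Sum.swap) (λ _ → Data.Sum.swap))
      (enumerates-tail (HamCycleVia.enumerates Γ₁.cycle-x)) e
      (P₁.rest-walk Γ₁.cycle-x) (P₁.a≢b' ∘ sym) j q (AE-sym edge-b₁'b₂)

  delete-b₁b₂ : HamiltonianDel H (Del₂ H (inj₁ b₁) (ι₂ b₂))
  delete-b₁b₂ with via-drop-start Γ₂.cycle-b
  ... | z , m , a₂'z , q , e =
    glue₂ split (HamCycleVia.enumerates C) (enumerates-tail e)
      p P₁.a≢a' (edge-a' (P₂.kept P₂.a'≢b z≢b₂ a₂'z)) (P₂.kept-walk b₂∉m q)
      (AE-sym (edge-a (P₂.kept-a (E-sym G₂ (HamCycleVia.tv Γ₂.cycle-b)) (via-end-avoids Γ₂.cycle-b))))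
    where
    C : HamCycleVia G₁ (Del₁ G₁ b₁) a₁ y₁ a₁'
    C = via-reverse Γ₁.cycle-b
    p : Walk P₁.Kept a₁ (a₁ ∷ HamCycleVia.rest C) a₁'
    p = step (P₁.kept-a (HamCycleVia.vs C) (via-start-avoids C))
             (P₁.kept-walk (via-deleted-∉ C refl) (HamCycleVia.path C))
    b₂∉m : b₂ ∉ m
    b₂∉m b₂∈m = All.lookup (Enumerates.avoids e) (there b₂∈m) (inj₁ refl)
    z≢b₂ : z ≢ b₂
    z≢b₂ refl = b₂∉m (walk-start-∈ q)
    split : Split (Del₂ H (inj₁ b₁) (ι₂ b₂)) (Del₁ G₁ b₁) (λ w → (w ≡ b₂ ⊎ w ≡ a₂') ⊎ w ≡ a₂)
    split = record
      { a₂-dropped = inj₂ refl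
      ; a'-once    = inj₂ (inj₁ (inj₂ refl))
      ; deleted₁   = λ { _ (inj₁ z≡b₁) → inj₁-injective z≡b₁
                       ; _ (inj₂ z≡b₂) →
                           ⊥-elim ([ P₂.a≢b ∘ sym , P₂.a'≢b ∘ sym ]′ (ι₂-shared (sym z≡b₂))) }
      ; deleted₂   = λ { _ (inj₁ w≡b₁) → [ inj₂ , inj₁ ∘ inj₂ ]′ (ι₂-shared w≡b₁)
                       ; w (inj₂ w≡b₂) → inj₁ (inj₁ (ι₂-inj w b₂ w≡b₂)) }
      ; present₁   = λ _ ¬X → inj₁ (¬X ∘ inj₁ ∘ cong inj₁)
      ; present₂   = λ { _ _ _ ¬X (inj₁ (inj₁ refl)) → ¬X (inj₂ refl)
                       ; _ _ w≢a₂' _ (inj₁ (inj₂ w≡a₂')) → w≢a₂' w≡a₂'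
                       ; _ w≢a₂ _ _ (inj₂ w≡a₂) → w≢a₂ w≡a₂ }
      }

  delete-b₁b₂' : HamiltonianDel H (Del₂ H (inj₁ b₁) (ι₂ b₂'))
  delete-b₁b₂' with a-to-b₂ Γ₂.cycle-b'
  ... | _ , _ , j , q , e =
    glue₂ split (enumerates-tail (HamCycleVia.enumerates Γ₁.cycle-a'-bb')) e
      (P₁.rest-walk Γ₁.cycle-a'-bb') (P₁.a≢b' ∘ sym) j q (AE-sym edge-b₁'b₂)
    where
    split : Split (Del₂ H (inj₁ b₁) (ι₂ b₂')) (Del₂ G₁ a₁' b₁) (Del₂ G₂ b₂' a₂)
    split = record
      { a₂-dropped = inj₂ refl
      ; a'-once    = inj₁ (inj₁ refl)
      ; deleted₁   = λ { _ (inj₁ z≡b₁) → inj₂ (inj₁-injective z≡b₁)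
                       ; _ (inj₂ z≡b₂') →
                           ⊥-elim ([ P₂.a≢b' ∘ sym , P₂.a'≢b' ∘ sym ]′ (ι₂-shared (sym z≡b₂'))) }
      ; deleted₂   = deleted₂
      ; present₁   = present₁
      ; present₂   = λ w w≢a₂ _ ¬X → [ ¬X ∘ inj₂ ∘ cong ι₂ , w≢a₂ ]′
      }
      where
      deleted₂ : ∀ w → Del₂ H (inj₁ b₁) (ι₂ b₂') (ι₂ w) → Del₂ G₂ b₂' a₂ w
      deleted₂ w (inj₁ w≡b₁) with ι₂≡inj₁ w≡b₁
      ... | inj₁ (w≡a₂ , _)   = inj₂ w≡a₂
      ... | inj₂ (_ , b₁≡a₁') = ⊥-elim (P₁.a'≢b (sym b₁≡a₁'))
      deleted₂ w (inj₂ w≡b₂') = inj₁ (ι₂-inj w b₂' w≡b₂')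
      present₁ : ∀ z → ¬ Del₂ H (inj₁ b₁) (ι₂ b₂') (inj₁ z) →
                 ¬ Del₂ G₁ a₁' b₁ z ⊎ (z ≡ a₁' × ¬ Del₂ G₂ b₂' a₂ a₂')
      present₁ z ¬X with _≟_ G₁ z a₁'
      ... | yes refl  = inj₂ (refl , [ P₂.a'≢b' , P₂.a≢a' ∘ sym ]′)
      ... | no z≢a₁' = inj₁ [ z≢a₁' , ¬X ∘ inj₁ ∘ cong inj₁ ]′

  edge-in-G₁ : ∀ u v → Amalgam.E₁' T₁ T₂ u v → HamiltonianDel H (Del₂ H (inj₁ u) (inj₁ v))
  edge-in-G₁ u v e with _≟_ G₁ u b₁ | _≟_ G₁ v b₁
  ... | yes refl | _ =
    subst (λ w → HamiltonianDel H (Del₂ H (inj₁ b₁) (inj₁ w))) (sym (P₁.kept-from-b e))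
          (Del₂-sym delete-x₁b₁)
  ... | no _ | yes refl =
    subst (λ w → HamiltonianDel H (Del₂ H (inj₁ w) (inj₁ b₁))) (sym (P₁.kept-from-b (P₁.kept-sym e)))
          delete-x₁b₁
  ... | no u≢b₁ | no v≢b₁ = side₁ u v u≢b₁ v≢b₁ (Conditions.k2ham C₁ u v (proj₁ e))

-- Symmetry of the amalgam

module Swap (T₁ T₂ : Tuple) where
  module A₁₂ = Amalgam T₁ T₂
  module A₂₁ = Amalgam T₂ T₁
  open Glue T₁ T₂ using (G₁; a₁; a₁'; b₁; b₁'; a₂; a₂'; b₂; H; ι₂-a; ι₂-a'; ι₂-kept; ι₂≡inj₁)
  open Glue T₂ T₁ using (kept₂-≢)

  φ : A₂₁.AV → A₁₂.AV
  φ (inj₁ w)       = A₁₂.ι₂ w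
  φ (inj₂ (z , _)) = inj₁ z

  φ-ι₂ : ∀ z → φ (A₂₁.ι₂ z) ≡ inj₁ z
  φ-ι₂ z with _≟_ G₁ z a₁
  ... | yes refl = ι₂-a
  ... | no _ with _≟_ G₁ z a₁'
  ...   | yes refl = ι₂-a'
  ...   | no _     = refl

  shared-kept : ∀ u {z} (k : T (A₂₁.keep₂ z)) → A₁₂.ι₂ u ≢ inj₁ z
  shared-kept u k eq with ι₂≡inj₁ eq
  ... | inj₁ (_ , refl) = proj₁ (kept₂-≢ k) refl
  ... | inj₂ (_ , refl) = proj₂ (kept₂-≢ k) refl

  φ-injective : ∀ {u w} → φ u ≡ φ w → u ≡ w
  φ-injective {inj₁ u}       {inj₁ w}       eq   = cong inj₁ (A₁₂.ι₂-inj u w eq)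
  φ-injective {inj₂ (z , k)} {inj₂ (.z , k')} refl = cong (λ k'' → inj₂ (z , k'')) (T-irrelevant k k')
  φ-injective {inj₁ u}       {inj₂ (z , k)} eq   = ⊥-elim (shared-kept u k eq)
  φ-injective {inj₂ (z , k)} {inj₁ u}       eq   = ⊥-elim (shared-kept u k (sym eq))

  φ-surjective : ∀ w → ∃[ u ] φ u ≡ w
  φ-surjective (inj₂ (w , k)) = inj₁ w , ι₂-kept w k
  φ-surjective (inj₁ z) with _≟_ G₁ z a₁
  ... | yes refl = inj₁ a₂ , ι₂-a
  ... | no z≢a₁ with _≟_ G₁ z a₁'
  ...   | yes refl  = inj₁ a₂' , ι₂-a'
  ...   | no z≢a₁' = inj₂ (z , A₂₁.keep-lemma z z≢a₁ z≢a₁') , refl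

  φ-SamePair : ∀ {u w p q r} → SamePair u w p q → φ q ≡ r → SamePair (φ u) (φ w) r (φ p)
  φ-SamePair (inj₁ (refl , refl)) refl = inj₂ (refl , refl)
  φ-SamePair (inj₂ (refl , refl)) refl = inj₁ (refl , refl)

  φ-edge : ∀ {u w} → A₂₁.AE u w → A₁₂.AE (φ u) (φ w)
  φ-edge (inj₁ (z , z' , refl , refl , e)) = inj₂ (inj₁ (z , z' , refl , refl , e))
  φ-edge (inj₂ (inj₁ (z , z' , refl , refl , e))) = inj₁ (z , z' , φ-ι₂ z , φ-ι₂ z' , e)
  φ-edge (inj₂ (inj₂ (inj₁ e)))        = inj₂ (inj₂ (inj₁ (φ-SamePair e (φ-ι₂ _))))
  φ-edge (inj₂ (inj₂ (inj₂ (inj₁ e)))) = inj₂ (inj₂ (inj₂ (inj₂ (φ-SamePair e (φ-ι₂ _)))))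
  φ-edge (inj₂ (inj₂ (inj₂ (inj₂ e)))) = inj₂ (inj₂ (inj₂ (inj₁ (φ-SamePair e (φ-ι₂ _)))))

  transport : ∀ {u v} → HamiltonianDel (amalgam T₂ T₁) (Del₂ (amalgam T₂ T₁) u v) →
              HamiltonianDel H (Del₂ H (φ u) (φ v))
  transport = ham-map φ φ-injective φ-surjective φ-edge

  module _ (C₁ : Conditions T₁) (C₂ : Conditions T₂) where

    edge-in-G₂ : ∀ u v → Amalgam.E₂' T₁ T₂ u v → HamiltonianDel H (Del₂ H (A₁₂.ι₂ u) (A₁₂.ι₂ v))
    edge-in-G₂ u v e = transport (Cases.edge-in-G₁ T₂ T₁ C₂ C₁ u v e)

    delete-b₁'b₂ : HamiltonianDel H (Del₂ H (inj₁ b₁') (A₁₂.ι₂ b₂))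
    delete-b₁'b₂ = Del₂-sym (subst (λ z → HamiltonianDel H (Del₂ H (A₁₂.ι₂ b₂) z)) (φ-ι₂ b₁')
                                   (transport (Cases.delete-b₁b₂' T₂ T₁ C₂ C₁)))

lemma8 : (T₁ T₂ : Tuple)
       → Finite (Tuple.G T₁) → Finite (Tuple.G T₂)
       → Conditions T₁ → Conditions T₂
       → K2Hamiltonian (amalgam T₁ T₂)
lemma8 T₁ T₂ _ _ C₁ C₂ = K₂-hamiltonian
  where
  open Cases T₁ T₂ C₁ C₂
  open Swap T₁ T₂ using (edge-in-G₂; delete-b₁'b₂)
  K₂-hamiltonian : K2Hamiltonian (amalgam T₁ T₂)
  K₂-hamiltonian _ _ (inj₁ (u , v , refl , refl , e))        = edge-in-G₁ u v e
  K₂-hamiltonian _ _ (inj₂ (inj₁ (u , v , refl , refl , e))) = edge-in-G₂ C₁ C₂ u v e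
  K₂-hamiltonian _ _ (inj₂ (inj₂ (inj₁ e)))                 = Del₂-pair e delete-b₁b₂
  K₂-hamiltonian _ _ (inj₂ (inj₂ (inj₂ (inj₁ e))))          = Del₂-pair e delete-b₁b₂'
  K₂-hamiltonian _ _ (inj₂ (inj₂ (inj₂ (inj₂ e))))          = Del₂-pair e (delete-b₁'b₂ C₁ C₂)
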